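{- For every integer $k\ge3$, every satellite graph $G=S_{2k+1}$ has all of the following properties: (1) $G$ is a core graph; (2) $0$ is a main eigenvalue of $A_G$; (3) every vertex of $G$ lies on a triangle; (4) for every vertex $u$ and every $w\in N(u)$, the vertices $u,w$ lie on a common triangle; (5) $G$ is not regular; (6) $G$ is connected; (7) $G$ is not bipartite; (8) the diameter of $G$ is $2$ or $3$.
   Context: For an integer $k\ge3$, a satellite graph $S_{2k+1}$ is a simple graph on $2k+1$ vertices whose vertex set is partitioned into a single vertex $v_{\mathrm{dom}}$, a set $V_4=\{u_1,\dots,u_k\}$ and a set $V_2=\{w_1,\dots,w_k\}$, with edges: $v_{\mathrm{dom}}$ is adjacent to every other vertex; each vertex of $V_4$ is adjacent to exactly two vertices of $V_4$ and exactly one vertex of $V_2$; each vertex of $V_2$ is adjacent to exactly one vertex of $V_4$ (and to $v_{\mathrm{dom}}$); no other edges. A graph is a core graph if its adjacency matrix has a null vector all of whose entries are nonzero. An eigenvalue of $A_G$ is main if some associated eigenvector is not orthogonal to the all-ones vector. -}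

module Defs where

open import Data.Nat using (ℕ; zero; suc; _+_; _≤_; _*_)
open import Data.Fin using (Fin)
open import Data.Bool using (Bool; true; false; if_then_else_)
open import Data.List using (List; foldr; map; allFin)
open import Data.Product using (Σ; ∃; ∃-syntax; _×_; _,_)
open import Data.Sum using (_⊎_)
open import Relation.Binary.PropositionalEquality using (_≡_; _≢_)
open import Relation.Nullary using (¬_)
open import Data.Rational using (ℚ; 0ℚ; 1ℚ) renaming (_+_ to _+ℚ_; _*_ to _*ℚ_)

record SimpleGraph (n : ℕ) : Set where
  field
    adj    : Fin n → Fin n → Bool
    sym    : ∀ u v → adj u v ≡ adj v u
    irrefl : ∀ v → adj v v ≡ false
open SimpleGraph public

module _ {n : ℕ} (G : SimpleGraph n) where

  Adj : Fin n → Fin n → Set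
  Adj u v = adj G u v ≡ true

  degree : Fin n → ℕ
  degree v = foldr _+_ 0 (map (λ u → if adj G v u then 1 else 0) (allFin n))

  adjMatrix : Fin n → Fin n → ℚ
  adjMatrix u v = if adj G u v then 1ℚ else 0ℚ

  sumℚ : (Fin n → ℚ) → ℚ
  sumℚ f = foldr _+ℚ_ 0ℚ (map f (allFin n))

  mulVec : (Fin n → ℚ) → Fin n → ℚ
  mulVec x i = sumℚ (λ j → adjMatrix i j *ℚ x j)

  IsNullVector : (Fin n → ℚ) → Set
  IsNullVector x = ∀ i → mulVec x i ≡ 0ℚ

  IsCore : Set
  IsCore = Σ (Fin n → ℚ) λ x → IsNullVector x × (∀ i → x i ≢ 0ℚ)

  -- eigenvalue λ is main: some eigenvector for λ is not orthogonal to 𝟙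
  IsMainEigenvalue : ℚ → Set
  IsMainEigenvalue λ₀ = Σ (Fin n → ℚ) λ x →
    (∀ i → mulVec x i ≡ λ₀ *ℚ x i) × (¬ (∀ i → x i ≡ 0ℚ)) × (sumℚ x ≢ 0ℚ)

  OnTriangle : Fin n → Set
  OnTriangle v = ∃[ a ] ∃[ b ] (Adj v a × Adj v b × Adj a b)

  EdgeOnTriangle : Fin n → Fin n → Set
  EdgeOnTriangle u w = ∃[ x ] (Adj u w × Adj u x × Adj w x)

  IsRegular : Set
  IsRegular = ∃[ r ] (∀ v → degree v ≡ r)

  data Walk : ℕ → Fin n → Fin n → Set where
    here : ∀ {v} → Walk zero v v
    step : ∀ {m u v x} → Adj u v → Walk m v x → Walk (suc m) u x

  Connected : Set
  Connected = ∀ u v → ∃[ m ] Walk m u v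

  IsBipartite : Set
  IsBipartite = Σ (Fin n → Bool) λ c → ∀ u v → Adj u v → c u ≢ c v

  HasDiameter : ℕ → Set
  HasDiameter d =
    (∀ u v → ∃[ m ] (m ≤ d × Walk m u v)) ×
    (∃[ u ] ∃[ v ] ((∃[ m ] Walk m u v) × (∀ m → Walk m u v → d ≤ m)))

record IsSatellite (k : ℕ) (G : SimpleGraph (suc (2 * k))) : Set where
  field
    vdom : Fin (suc (2 * k))
    u    : Fin k → Fin (suc (2 * k))
    w    : Fin k → Fin (suc (2 * k))
    u-inj   : ∀ i j → u i ≡ u j → i ≡ j
    w-inj   : ∀ i j → w i ≡ w j → i ≡ j
    u≢dom   : ∀ i → u i ≢ vdom
    w≢dom   : ∀ i → w i ≢ vdom
    u≢w     : ∀ i j → u i ≢ w j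
    cover   : ∀ v → v ≡ vdom ⊎ (∃[ i ] v ≡ u i) ⊎ (∃[ i ] v ≡ w i)
    dom-adj : ∀ v → v ≢ vdom → Adj G vdom v
    u-uu    : ∀ i → ∃[ j ] ∃[ j′ ] (j ≢ j′ × Adj G (u i) (u j) × Adj G (u i) (u j′)
                × (∀ l → Adj G (u i) (u l) → l ≡ j ⊎ l ≡ j′))
    u-w     : ∀ i → ∃[ j ] (Adj G (u i) (w j) × (∀ l → Adj G (u i) (w l) → l ≡ j))
    w-u     : ∀ i → ∃[ j ] (Adj G (w i) (u j) × (∀ l → Adj G (w i) (u l) → l ≡ j))
    w-w     : ∀ i j → ¬ Adj G (w i) (w j)

-- The vector that is 1 on V₄ and −1 on v_dom and V₂ is a nowhere-zero null
-- vector: every vertex has as many neighbours in V₄ as outside it (v_dom: k and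
-- k, a vertex of V₄: two and two, a vertex of V₂: one and one).  Its entries
-- sum to k − (k + 1) = −1, so 0 is a main eigenvalue.  Sums over the vertex set
-- split into v_dom and the two families u, w by enumerating the vertices as
-- Fin (1 + (k + k)).  Everything else comes from the dominating vertex v_dom:
-- an edge avoiding v_dom closes a triangle with it, every other vertex has a
-- neighbour besides v_dom, all distances are ≤ 2, and two vertices of V₂ are
-- at distance exactly 2.
module Submission where

open import Defs hiding (sym)
open import Data.Nat as ℕ using (ℕ; zero; suc; _≤_; z≤n; s≤s)
open import Data.Product using (∃-syntax; _×_; _,_)
open import Data.Sum using (_⊎_; inj₁; inj₂; [_,_]; [_,_]′)
open import Relation.Nullary using (¬_; yes; no)
open import Data.Rational using (0ℚ)

open import Algebra.Bundles using (CommutativeMonoid; Semiring)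
open import Data.Bool using (Bool; true; false; if_then_else_)
open import Data.Empty using (⊥-elim)
open import Data.Fin using (Fin; zero; suc; _↑ˡ_; _↑ʳ_; splitAt; join; punchIn; punchOut)
open import Data.Fin.Permutation using (Permutation; permutation)
open import Data.Fin.Properties
  using (_≟_; splitAt-↑ˡ; splitAt-↑ʳ; join-splitAt; punchIn-injective; punchInᵢ≢i; punchIn-punchOut)
open import Data.List as List using (allFin)
open import Data.List.Properties using (map-tabulate)
open import Data.Vec.Functional as Vector using (Vector)
open import Function using (_∘_; id; const)
open import Relation.Binary.PropositionalEquality as ≡ using (_≡_; _≢_)

module CommutativeMonoidSum {a ℓ} (M : CommutativeMonoid a ℓ) where
  open CommutativeMonoid M renaming (_∙_ to _+_; ε to 0#; ∙-congˡ to +-congˡ)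
  open import Algebra.Properties.CommutativeMonoid.Sum M public
  open import Relation.Binary.Reasoning.Setoid setoid

  sum-↑ : ∀ m n (f : Vector Carrier (m ℕ.+ n)) →
          sum f ≈ sum (f ∘ (_↑ˡ n)) + sum (f ∘ (m ↑ʳ_))
  sum-↑ zero    n f = sym (identityˡ _)
  sum-↑ (suc m) n f = begin
    f zero + sum (f ∘ suc)                                          ≈⟨ +-congˡ (sum-↑ m n (f ∘ suc)) ⟩
    f zero + (sum (f ∘ suc ∘ (_↑ˡ n)) + sum (f ∘ suc ∘ (m ↑ʳ_)))    ≈⟨ assoc _ _ _ ⟨
    (f zero + sum (f ∘ suc ∘ (_↑ˡ n))) + sum (f ∘ suc ∘ (m ↑ʳ_))    ∎

  sum-zero : ∀ {m} (g : Vector Carrier m) → (∀ l → g l ≈ 0#) → sum g ≈ 0#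
  sum-zero {m} g g≈0 = trans (sum-cong-≋ g≈0) (sum-replicate-zero m)

  sum-single : ∀ {m} (g : Vector Carrier m) σ → (∀ l → l ≢ σ → g l ≈ 0#) → sum g ≈ g σ
  sum-single {suc m} g σ g≈0 = begin
    sum g                        ≈⟨ sum-remove g ⟩
    g σ + sum (g ∘ punchIn σ)    ≈⟨ +-congˡ (sum-zero _ (λ l → g≈0 _ (punchInᵢ≢i σ l))) ⟩
    g σ + 0#                     ≈⟨ identityʳ _ ⟩
    g σ                          ∎

  sum-pair : ∀ {m} (g : Vector Carrier m) {σ τ} → σ ≢ τ →
             (∀ l → l ≢ σ → l ≢ τ → g l ≈ 0#) → sum g ≈ g σ + g τ
  sum-pair {suc m} g {σ} {τ} σ≢τ g≈0 = begin
    sum g                        ≈⟨ sum-remove g ⟩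
    g σ + sum (g ∘ punchIn σ)    ≈⟨ +-congˡ (sum-single _ τ′ off-τ′) ⟩
    g σ + g (punchIn σ τ′)       ≡⟨ ≡.cong (λ v → g σ + g v) τ′↦τ ⟩
    g σ + g τ                    ∎
    where
    τ′ = punchOut σ≢τ
    τ′↦τ = punchIn-punchOut σ≢τ
    off-τ′ : ∀ l → l ≢ τ′ → g (punchIn σ l) ≈ 0#
    off-τ′ l l≢τ′ = g≈0 _ (punchInᵢ≢i σ l)
      (λ l↦τ → l≢τ′ (punchIn-injective σ l τ′ (≡.trans l↦τ (≡.sym τ′↦τ))))

module Counting {c ℓ} (R : Semiring c ℓ) where
  open Semiring R
  open CommutativeMonoidSum +-commutativeMonoid using (sum-cong-≋; sum-replicate; sum-single; sum-pair)
  open CommutativeMonoidSum +-commutativeMonoid public using (sum; sum-zero)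
  open import Algebra.Properties.Semiring.Sum R using (*-distribʳ-sum)
  -- the scalar multiple n × x of Algebra.Definitions.RawMonoid, renamed to avoid Data.Product._×_
  open import Algebra.Definitions.RawMonoid +-rawMonoid public using () renaming (_×_ to _times_)

  χ : Bool → Carrier
  χ b = if b then 1# else 0#

  count : ∀ {m} → Vector Bool m → Carrier
  count p = sum (χ ∘ p)

  χ-true : ∀ {b} → b ≡ true → χ b ≈ 1#
  χ-true ≡.refl = refl

  χ-false : ∀ {b} → b ≢ true → χ b ≈ 0#
  χ-false {true}  b≢true = ⊥-elim (b≢true ≡.refl)
  χ-false {false} _      = refl

  sum-*-const : ∀ {m} (g y : Vector Carrier m) {c} → (∀ i → y i ≈ c) →
                sum (λ i → g i * y i) ≈ sum g * c
  sum-*-const g y y≈c = trans (sum-cong-≋ (λ i → *-congˡ (y≈c i))) (sym (*-distribʳ-sum _ g))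

  count-none : ∀ {m} (p : Vector Bool m) → (∀ l → p l ≢ true) → count p ≈ 0#
  count-none p none = sum-zero _ (λ l → χ-false (none l))

  count-single : ∀ {m} (p : Vector Bool m) {σ} → p σ ≡ true →
                 (∀ l → p l ≡ true → l ≡ σ) → count p ≈ 1#
  count-single p {σ} pσ only-σ =
    trans (sum-single _ σ (λ l l≢σ → χ-false (l≢σ ∘ only-σ l))) (χ-true pσ)

  count-pair : ∀ {m} (p : Vector Bool m) {σ τ} → σ ≢ τ → p σ ≡ true → p τ ≡ true →
               (∀ l → p l ≡ true → l ≡ σ ⊎ l ≡ τ) → count p ≈ 1# + 1#
  count-pair p σ≢τ pσ pτ only-στ =
    trans (sum-pair _ σ≢τ (λ l l≢σ l≢τ → χ-false (λ pl → [ l≢σ , l≢τ ] (only-στ l pl))))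
          (+-cong (χ-true pσ) (χ-true pτ))

  count-all : ∀ {m} (p : Vector Bool m) → (∀ l → p l ≡ true) → count p ≈ m times 1#
  count-all {m} p all = trans (sum-cong-≋ (λ l → χ-true (all l))) (sum-replicate m)

foldr-map-allFin : ∀ {a} {A : Set a} (_∙_ : A → A → A) (ε : A) {n} (f : Fin n → A) →
                   List.foldr _∙_ ε (List.map f (allFin n)) ≡ Vector.foldr _∙_ ε f
foldr-map-allFin _∙_ ε {n} f = ≡.trans (≡.cong (List.foldr _∙_ ε) (map-tabulate id f)) (go n f)
  where
  go : ∀ n (f : Fin n → _) → List.foldr _∙_ ε (List.tabulate f) ≡ Vector.foldr _∙_ ε f
  go zero    f = ≡.refl
  go (suc n) f = ≡.cong (f zero ∙_) (go n (f ∘ suc))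

module _ {n} (G : SimpleGraph n) where

  Dominating : Fin n → Set
  Dominating d = ∀ v → v ≢ d → Adj G d v

  Adj-sym : ∀ {a b} → Adj G a b → Adj G b a
  Adj-sym {a} {b} ab = ≡.trans (SimpleGraph.sym G b a) ab

  Adj-irrefl : ∀ {a} → ¬ Adj G a a
  Adj-irrefl {a} aa with ≡.trans (≡.sym (irrefl G a)) aa
  ... | ()

  dominating⇒walk≤2 : ∀ {d} → Dominating d → ∀ a b → ∃[ m ] (m ≤ 2 × Walk G m a b)
  dominating⇒walk≤2 {d} dominating a b with a ≟ b | a ≟ d | b ≟ d
  ... | yes ≡.refl | _          | _          = 0 , z≤n , here
  ... | no a≢b     | yes ≡.refl | _          = 1 , s≤s z≤n , step (dominating b (a≢b ∘ ≡.sym)) here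
  ... | no a≢b     | no a≢d     | yes ≡.refl = 1 , s≤s z≤n , step (Adj-sym (dominating a a≢d)) here
  ... | no a≢b     | no a≢d     | no b≢d     =
    2 , s≤s (s≤s z≤n) , step (Adj-sym (dominating a a≢d)) (step (dominating b b≢d) here)

  walk-length≥2 : ∀ {a b} → a ≢ b → ¬ Adj G a b → ∀ m → Walk G m a b → 2 ≤ m
  walk-length≥2 a≢b _   zero          here           = ⊥-elim (a≢b ≡.refl)
  walk-length≥2 _   ¬ab (suc zero)    (step ab here) = ⊥-elim (¬ab ab)
  walk-length≥2 _   _   (suc (suc m)) _              = s≤s (s≤s z≤n)

  dominating⇒diameter-2 : ∀ {d} → Dominating d → ∀ {a b} → a ≢ b → ¬ Adj G a b → HasDiameter G 2
  dominating⇒diameter-2 dominating {a} {b} a≢b ¬ab =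
    dominating⇒walk≤2 dominating , (a , b , walk , walk-length≥2 a≢b ¬ab)
    where
    walk : ∃[ m ] Walk G m a b
    walk with dominating⇒walk≤2 dominating a b
    ... | m , _ , p = m , p

  diameter⇒connected : ∀ {d} → HasDiameter G d → Connected G
  diameter⇒connected (walks , _) a b with walks a b
  ... | m , _ , p = m , p

  onTriangle⇒¬bipartite : ∀ {a} → OnTriangle G a → ¬ IsBipartite G
  onTriangle⇒¬bipartite {a} (b , c , ab , ac , bc) (colour , proper)
    with colour a | colour b | colour c | proper _ _ ab | proper _ _ bc | proper _ _ ac
  ... | true  | true  | _     | a≢b | _   | _   = a≢b ≡.refl
  ... | false | false | _     | a≢b | _   | _   = a≢b ≡.refl
  ... | true  | false | true  | _   | _   | a≢c = a≢c ≡.refl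
  ... | true  | false | false | _   | b≢c | _   = b≢c ≡.refl
  ... | false | true  | true  | _   | b≢c | _   = b≢c ≡.refl
  ... | false | true  | false | _   | _   | a≢c = a≢c ≡.refl

module Satellite {k} {G : SimpleGraph (suc (2 ℕ.* k))} (S : IsSatellite k G) where
  open IsSatellite S

  private
    n : ℕ
    n = suc (2 ℕ.* k)

    Part : Fin n → Set
    Part v = v ≡ vdom ⊎ (∃[ i ] v ≡ u i) ⊎ (∃[ i ] v ≡ w i)

    indexOf : ∀ {v} → Part v → Fin (suc (k ℕ.+ k))
    indexOf (inj₁ _)              = zero
    indexOf (inj₂ (inj₁ (i , _))) = suc (i ↑ˡ k)
    indexOf (inj₂ (inj₂ (i , _))) = suc (k ↑ʳ i)

  vertex : Fin (suc (k ℕ.+ k)) → Fin n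
  vertex zero    = vdom
  vertex (suc i) = [ u , w ]′ (splitAt k i)

  index : Fin n → Fin (suc (k ℕ.+ k))
  index v = indexOf (cover v)

  vertex-u : ∀ i → vertex (suc (i ↑ˡ k)) ≡ u i
  vertex-u i = ≡.cong [ u , w ]′ (splitAt-↑ˡ k i k)

  vertex-w : ∀ i → vertex (suc (k ↑ʳ i)) ≡ w i
  vertex-w i = ≡.cong [ u , w ]′ (splitAt-↑ʳ k k i)

  vertex-index : ∀ v → vertex (index v) ≡ v
  vertex-index v = go (cover v)
    where
    go : ∀ {v} (p : Part v) → vertex (indexOf p) ≡ v
    go (inj₁ v≡vdom)            = ≡.sym v≡vdom
    go (inj₂ (inj₁ (i , v≡ui))) = ≡.trans (vertex-u i) (≡.sym v≡ui)
    go (inj₂ (inj₂ (i , v≡wi))) = ≡.trans (vertex-w i) (≡.sym v≡wi)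

  index-vdom : index vdom ≡ zero
  index-vdom with cover vdom
  ... | inj₁ _                    = ≡.refl
  ... | inj₂ (inj₁ (i , vdom≡ui)) = ⊥-elim (u≢dom i (≡.sym vdom≡ui))
  ... | inj₂ (inj₂ (i , vdom≡wi)) = ⊥-elim (w≢dom i (≡.sym vdom≡wi))

  index-u : ∀ i → index (u i) ≡ suc (i ↑ˡ k)
  index-u i with cover (u i)
  ... | inj₁ ui≡vdom            = ⊥-elim (u≢dom i ui≡vdom)
  ... | inj₂ (inj₁ (j , ui≡uj)) = ≡.cong (λ l → suc (l ↑ˡ k)) (u-inj j i (≡.sym ui≡uj))
  ... | inj₂ (inj₂ (j , ui≡wj)) = ⊥-elim (u≢w i j ui≡wj)

  index-w : ∀ i → index (w i) ≡ suc (k ↑ʳ i)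
  index-w i with cover (w i)
  ... | inj₁ wi≡vdom            = ⊥-elim (w≢dom i wi≡vdom)
  ... | inj₂ (inj₁ (j , wi≡uj)) = ⊥-elim (u≢w j i (≡.sym wi≡uj))
  ... | inj₂ (inj₂ (j , wi≡wj)) = ≡.cong (λ l → suc (k ↑ʳ l)) (w-inj j i (≡.sym wi≡wj))

  index-vertex : ∀ i → index (vertex i) ≡ i
  index-vertex zero    = index-vdom
  index-vertex (suc i) = ≡.trans (go (splitAt k i)) (≡.cong suc (join-splitAt k k i))
    where
    go : ∀ s → index ([ u , w ]′ s) ≡ suc (join k k s)
    go (inj₁ j) = index-u j
    go (inj₂ j) = index-w j

  enumeration : Permutation (suc (k ℕ.+ k)) n
  enumeration = permutation vertex index vertex-index index-vertex

  module _ {a ℓ} (M : CommutativeMonoid a ℓ) where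
    open CommutativeMonoid M renaming (_∙_ to _+_; ∙-congˡ to +-congˡ)
    open CommutativeMonoidSum M
    open import Relation.Binary.Reasoning.Setoid setoid

    sum-vertices : (f : Vector Carrier n) → sum f ≈ f vdom + (sum (f ∘ u) + sum (f ∘ w))
    sum-vertices f = begin
      sum f                                                           ≈⟨ ∑-permute f enumeration ⟩
      f vdom + sum (f ∘ vertex ∘ suc)                                 ≈⟨ +-congˡ (sum-↑ k k (f ∘ vertex ∘ suc)) ⟩
      f vdom + (sum (f ∘ vertex ∘ suc ∘ (_↑ˡ k)) + sum (f ∘ vertex ∘ suc ∘ (k ↑ʳ_)))
        ≡⟨ ≡.cong₂ (λ s t → f vdom + (s + t)) (sum-cong-≗ (≡.cong f ∘ vertex-u)) (sum-cong-≗ (≡.cong f ∘ vertex-w)) ⟩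
      f vdom + (sum (f ∘ u) + sum (f ∘ w))                            ∎

  Adj-vdom : ∀ v → v ≢ vdom → Adj G v vdom
  Adj-vdom v v≢vdom = Adj-sym G (dom-adj v v≢vdom)

  module _ {c ℓ} (R : Semiring c ℓ) where
    open Semiring R
    open Counting R

    count-vdom-u : count (adj G vdom ∘ u) ≈ k times 1#
    count-vdom-u = count-all _ (λ i → dom-adj (u i) (u≢dom i))

    count-vdom-w : count (adj G vdom ∘ w) ≈ k times 1#
    count-vdom-w = count-all _ (λ i → dom-adj (w i) (w≢dom i))

    count-u-u : ∀ i → count (adj G (u i) ∘ u) ≈ 1# + 1#
    count-u-u i with u-uu i
    ... | j , j′ , j≢j′ , adj-j , adj-j′ , only = count-pair _ j≢j′ adj-j adj-j′ only

    count-u-w : ∀ i → count (adj G (u i) ∘ w) ≈ 1#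
    count-u-w i with u-w i
    ... | j , adj-j , only = count-single _ adj-j only

    count-w-u : ∀ i → count (adj G (w i) ∘ u) ≈ 1#
    count-w-u i with w-u i
    ... | j , adj-j , only = count-single _ adj-j only

    count-w-w : ∀ i → count (adj G (w i) ∘ w) ≈ 0#
    count-w-w i = count-none _ (w-w i)

    balanced : ∀ v → χ (adj G v vdom) + count (adj G v ∘ w) ≈ count (adj G v ∘ u)
    balanced v with cover v
    ... | inj₁ ≡.refl = begin
      χ (adj G vdom vdom) + count (adj G vdom ∘ w)  ≡⟨ ≡.cong (λ b → χ b + count (adj G vdom ∘ w)) (irrefl G vdom) ⟩
      0# + count (adj G vdom ∘ w)                   ≈⟨ +-identityˡ _ ⟩
      count (adj G vdom ∘ w)                        ≈⟨ count-vdom-w ⟩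
      k times 1#                                    ≈⟨ count-vdom-u ⟨
      count (adj G vdom ∘ u)                        ∎
      where open import Relation.Binary.Reasoning.Setoid setoid
    ... | inj₂ (inj₁ (i , ≡.refl)) =
      trans (+-cong (χ-true (Adj-vdom (u i) (u≢dom i))) (count-u-w i)) (sym (count-u-u i))
    ... | inj₂ (inj₂ (i , ≡.refl)) =
      trans (+-cong (χ-true (Adj-vdom (w i) (w≢dom i))) (count-w-w i))
            (trans (+-identityʳ 1#) (sym (count-w-u i)))

  module _ where
    open import Data.Rational using (ℚ; 1ℚ; -_; _+_; _*_)
    open import Data.Rational.Properties using (+-*-commutativeRing; +-0-commutativeMonoid; *-zeroˡ)
    open import Data.Rational.Solver using (module +-*-Solver)
    open import Algebra.Bundles using (CommutativeRing)
    open Counting (CommutativeRing.semiring +-*-commutativeRing)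
    open CommutativeMonoidSum +-0-commutativeMonoid using (∑-distrib-+)
    open ≡.≡-Reasoning

    sign : Fin (suc (k ℕ.+ k)) → ℚ
    sign zero    = - 1ℚ
    sign (suc i) = [ const 1ℚ , const (- 1ℚ) ]′ (splitAt k i)

    sign≢0 : ∀ i → sign i ≢ 0ℚ
    sign≢0 zero = λ ()
    sign≢0 (suc i) with splitAt k i
    ... | inj₁ _ = λ ()
    ... | inj₂ _ = λ ()

    nullVector : Fin n → ℚ
    nullVector = sign ∘ index

    nullVector-vdom : nullVector vdom ≡ - 1ℚ
    nullVector-vdom = ≡.cong sign index-vdom

    nullVector-u : ∀ i → nullVector (u i) ≡ 1ℚ
    nullVector-u i = ≡.trans (≡.cong sign (index-u i)) (≡.cong [ const 1ℚ , const (- 1ℚ) ]′ (splitAt-↑ˡ k i k))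

    nullVector-w : ∀ i → nullVector (w i) ≡ - 1ℚ
    nullVector-w i = ≡.trans (≡.cong sign (index-w i)) (≡.cong [ const 1ℚ , const (- 1ℚ) ]′ (splitAt-↑ʳ k k i))

    private
      cancel : ∀ a b → a * - 1ℚ + ((a + b) * 1ℚ + b * - 1ℚ) ≡ 0ℚ
      cancel = solve 2 (λ a b → a :* :- con 1ℚ :+ ((a :+ b) :* con 1ℚ :+ b :* :- con 1ℚ) := con 0ℚ) ≡.refl
        where open +-*-Solver

    isNullVector : IsNullVector G nullVector
    isNullVector v = begin
      mulVec G nullVector v
        ≡⟨ foldr-map-allFin _+_ 0ℚ (λ j → adjMatrix G v j * nullVector j) ⟩
      sum (λ j → χ (adj G v j) * nullVector j)
        ≡⟨ sum-vertices +-0-commutativeMonoid (λ j → χ (adj G v j) * nullVector j) ⟩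
      a * nullVector vdom + (sum (λ i → χ (adj G v (u i)) * nullVector (u i))
                             + sum (λ i → χ (adj G v (w i)) * nullVector (w i)))
        ≡⟨ ≡.cong₂ (λ s t → a * s + t) nullVector-vdom
             (≡.cong₂ _+_ (sum-*-const _ _ nullVector-u) (sum-*-const _ _ nullVector-w)) ⟩
      a * - 1ℚ + (count (adj G v ∘ u) * 1ℚ + W * - 1ℚ)
        ≡⟨ ≡.cong (λ U → a * - 1ℚ + (U * 1ℚ + W * - 1ℚ)) (balanced (CommutativeRing.semiring +-*-commutativeRing) v) ⟨
      a * - 1ℚ + ((a + W) * 1ℚ + W * - 1ℚ)
        ≡⟨ cancel a W ⟩
      0ℚ ∎
      where
      a = χ (adj G v vdom)
      W = count (adj G v ∘ w)

    sum-nullVector : sumℚ G nullVector ≡ - 1ℚ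
    sum-nullVector = begin
      sumℚ G nullVector
        ≡⟨ foldr-map-allFin _+_ 0ℚ nullVector ⟩
      sum nullVector
        ≡⟨ sum-vertices +-0-commutativeMonoid nullVector ⟩
      nullVector vdom + (sum (nullVector ∘ u) + sum (nullVector ∘ w))
        ≡⟨ ≡.cong₂ _+_ nullVector-vdom (≡.sym (∑-distrib-+ (nullVector ∘ u) (nullVector ∘ w))) ⟩
      - 1ℚ + sum (λ i → nullVector (u i) + nullVector (w i))
        ≡⟨ ≡.cong (- 1ℚ +_) (sum-zero _ (λ i → ≡.cong₂ _+_ (nullVector-u i) (nullVector-w i))) ⟩
      - 1ℚ + 0ℚ
        ≡⟨⟩
      - 1ℚ ∎

    isCore : IsCore G
    isCore = nullVector , isNullVector , sign≢0 ∘ index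

    0ℚ-isMainEigenvalue : IsMainEigenvalue G 0ℚ
    0ℚ-isMainEigenvalue =
        nullVector
      , (λ v → ≡.trans (isNullVector v) (≡.sym (*-zeroˡ (nullVector v))))
      , (λ vanishes → sign≢0 (index vdom) (vanishes vdom))
      , (λ sum≡0 → sign≢0 zero (≡.trans (≡.sym sum-nullVector) sum≡0))

  module _ where
    open import Data.Nat.Properties using (+-*-semiring; +-0-commutativeMonoid; m+1+n≢0; suc-injective)
    open Counting +-*-semiring
    open ≡.≡-Reasoning

    times-1 : ∀ m → m times 1 ≡ m
    times-1 zero    = ≡.refl
    times-1 (suc m) = ≡.cong suc (times-1 m)

    degree-vertices : ∀ v → degree G v ≡ χ (adj G v vdom) ℕ.+ (count (adj G v ∘ u) ℕ.+ count (adj G v ∘ w))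
    degree-vertices v = ≡.trans (foldr-map-allFin ℕ._+_ 0 (χ ∘ adj G v))
                                (sum-vertices +-0-commutativeMonoid (χ ∘ adj G v))

    degree-vdom : degree G vdom ≡ k ℕ.+ k
    degree-vdom = ≡.trans (degree-vertices vdom)
      (≡.cong₂ (λ b c → χ b ℕ.+ c) (irrefl G vdom)
        (≡.cong₂ ℕ._+_ (≡.trans (count-vdom-u +-*-semiring) (times-1 k))
                        (≡.trans (count-vdom-w +-*-semiring) (times-1 k))))

    degree-w : ∀ i → degree G (w i) ≡ 2
    degree-w i = ≡.trans (degree-vertices (w i))
      (≡.cong₂ ℕ._+_ (χ-true (Adj-vdom (w i) (w≢dom i)))
        (≡.cong₂ ℕ._+_ (count-w-u +-*-semiring i) (count-w-w +-*-semiring i)))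

    ¬regular : 2 ≤ k → ¬ IsRegular G
    ¬regular (s≤s (s≤s {n = k′} _)) (r , regular) =
      m+1+n≢0 k′ (suc-injective (suc-injective k+k≡2))
      where
      k+k≡2 : k ℕ.+ k ≡ 2
      k+k≡2 = begin
        k ℕ.+ k           ≡⟨ degree-vdom ⟨
        degree G vdom     ≡⟨ regular vdom ⟩
        r                 ≡⟨ regular (w zero) ⟨
        degree G (w zero) ≡⟨ degree-w zero ⟩
        2                 ∎

  neighbour-off-vdom : ∀ v → v ≢ vdom → ∃[ y ] (Adj G v y × Adj G vdom y)
  neighbour-off-vdom v v≢vdom with cover v
  ... | inj₁ v≡vdom = ⊥-elim (v≢vdom v≡vdom)
  ... | inj₂ (inj₁ (i , ≡.refl)) with u-w i
  ...   | j , adj-j , _ = w j , adj-j , dom-adj (w j) (w≢dom j)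
  neighbour-off-vdom v v≢vdom | inj₂ (inj₂ (i , ≡.refl)) with w-u i
  ...   | j , adj-j , _ = u j , adj-j , dom-adj (u j) (u≢dom j)

  edgeOnTriangle : ∀ a b → Adj G a b → EdgeOnTriangle G a b
  edgeOnTriangle a b ab with a ≟ vdom | b ≟ vdom
  ... | yes ≡.refl | yes ≡.refl = ⊥-elim (Adj-irrefl G ab)
  ... | yes ≡.refl | no b≢vdom with neighbour-off-vdom b b≢vdom
  ...   | y , by , ay = y , ab , ay , by
  edgeOnTriangle a b ab | no a≢vdom | yes ≡.refl with neighbour-off-vdom a a≢vdom
  ...   | y , ay , by = y , ab , ay , by
  edgeOnTriangle a b ab | no a≢vdom | no b≢vdom =
    vdom , ab , Adj-vdom a a≢vdom , Adj-vdom b b≢vdom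

  neighbour : Fin k → ∀ v → ∃[ y ] Adj G v y
  neighbour i v with v ≟ vdom
  ... | yes ≡.refl = u i , dom-adj (u i) (u≢dom i)
  ... | no v≢vdom  = vdom , Adj-vdom v v≢vdom

  onTriangle : Fin k → ∀ v → OnTriangle G v
  onTriangle i v with neighbour i v
  ... | y , vy with edgeOnTriangle v y vy
  ...   | x , _ , vx , yx = y , x , vy , vx , yx

  diameter-2 : ∀ {i j} → i ≢ j → HasDiameter G 2
  diameter-2 {i} {j} i≢j = dominating⇒diameter-2 G dom-adj (i≢j ∘ w-inj i j) (w-w i j)

theorem4p3 : (k : ℕ) → 3 ≤ k → (G : SimpleGraph (suc (2 ℕ.* k))) → IsSatellite k G →
    IsCore G
    × IsMainEigenvalue G 0ℚ
    × (∀ v → OnTriangle G v)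
    × (∀ u w → Adj G u w → EdgeOnTriangle G u w)
    × ¬ IsRegular G
    × Connected G
    × ¬ IsBipartite G
    × (HasDiameter G 2 ⊎ HasDiameter G 3)
theorem4p3 k (s≤s (s≤s (s≤s _))) G S =
    isCore
  , 0ℚ-isMainEigenvalue
  , onTriangle zero
  , edgeOnTriangle
  , ¬regular (s≤s (s≤s z≤n))
  , diameter⇒connected G diameter
  , onTriangle⇒¬bipartite G (onTriangle zero vdom)
  , inj₁ diameter
  where
  open Satellite S
  open IsSatellite S using (vdom)
  diameter : HasDiameter G 2
  diameter = diameter-2 {zero} {suc zero} λ ()
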